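{- For every $n\geq 1$, the total number of descents summed over all Catalan words of length $n$ (the popularity of descents on $\mathcal{C}_n$) equals $\binom{2n-2}{n-3}$ (interpreted as $0$ when $n<3$), and its generating function $\sum_{n\geq 0}\big(\sum_{w\in\mathcal{C}_n} d(w)\big)x^n$ equals $$\frac{1-4x+2x^2-(1-2x)\sqrt{1-4x}}{2x\sqrt{1-4x}}.$$
   Context: A Catalan word of length $n\geq 1$ is a word $w_1w_2\ldots w_n$ over the non-negative integers with $w_1=0$ and $0\leq w_i\leq w_{i-1}+1$ for $i=2,\ldots,n$; the empty word is the unique Catalan word of length $0$. $\mathcal{C}_n$ denotes the set of Catalan words of length $n$. A descent of a word $w_1\ldots w_n$ is an index $i$ with $w_i>w_{i+1}$, and $d(w)$ is the number of descents of $w$. -}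

module Defs where

open import Data.Nat using (ℕ; zero; suc; _+_; _*_; _∸_; _<ᵇ_)
open import Data.Nat.Combinatorics using (_C_)
open import Data.Bool using (if_then_else_)
open import Data.List using (List; []; _∷_; [_]; _++_; map; concatMap; upTo)
open import Data.Nat.ListAction using (sum)
open import Data.Integer as ℤ using (ℤ; +_)
open import Relation.Binary.PropositionalEquality using (_≡_)

lastOr : List ℕ → ℕ → ℕ
lastOr []           d = d
lastOr (x ∷ [])     d = x
lastOr (x ∷ y ∷ ys) d = lastOr (y ∷ ys) d

-- Length 1: the word 0.
-- Length n+1 (n ≥ 1): w followed by a letter k with 0 ≤ k ≤ (last letter of w) + 1.
CatalanWords : ℕ → List (List ℕ)
CatalanWords zero = [ [] ]
CatalanWords (suc zero) = [ 0 ∷ [] ]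
CatalanWords (suc (suc n)) =
  concatMap (λ w → map (λ k → w ++ [ k ]) (upTo (suc (suc (lastOr w 0)))))
            (CatalanWords (suc n))

descents : List ℕ → ℕ
descents []           = 0
descents (x ∷ [])     = 0
descents (x ∷ y ∷ ys) = (if y <ᵇ x then 1 else 0) + descents (y ∷ ys)

popDes : ℕ → ℕ
popDes n = sum (map descents (CatalanWords n))

popFormula : ℕ → ℕ
popFormula zero = 0
popFormula (suc zero) = 0
popFormula (suc (suc zero)) = 0
popFormula n@(suc (suc (suc _))) = (2 * n ∸ 2) C (n ∸ 3)

FPS : Set
FPS = ℕ → ℤ

_≈_ : FPS → FPS → Set
f ≈ g = ∀ n → f n ≡ g n

infix 4 _≈_
infixl 6 _⊕_ _⊖_
infixl 7 _⊛_

_⊕_ : FPS → FPS → FPS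
(f ⊕ g) n = f n ℤ.+ g n

_⊖_ : FPS → FPS → FPS
(f ⊖ g) n = f n ℤ.- g n

sumTo : ℕ → (ℕ → ℤ) → ℤ
sumTo zero    f = f 0
sumTo (suc n) f = sumTo n f ℤ.+ f (suc n)

_⊛_ : FPS → FPS → FPS
(f ⊛ g) n = sumTo n (λ i → f i ℤ.* g (n ∸ i))

poly : List ℤ → FPS
poly []       n       = + 0
poly (c ∷ cs) zero    = c
poly (c ∷ cs) (suc n) = poly cs n

popGF : FPS
popGF n = + popDes n

module Submission where

-- Appending a letter i ≤ ℓ + 1 to a Catalan word with last letter ℓ produces every Catalan word of
-- the next length exactly once, and creates a descent exactly when i < ℓ.  Counting, for each
-- threshold k, the words of length n + 1 whose last letter is at least k, together with their
-- descents, therefore gives Pascal-type recurrences in k and n.  They are solved by the ballot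
-- numbers C(2n−k+1, n+1) − C(2n−k+1, n+2) and by C(2n−k−1, n+2) + (k+1)·C(2n−k−1, n+1); at k = 0
-- the latter is C(2n, n+2) = C(2n, n−2).
--
-- For the generating function let B = Σ C(2n,n) xⁿ and θ = x·d/dx.  The recurrence of the central
-- binomial coefficients reads (1 − 4x)·θB = 2x·B, and applying θ to S² = 1 − 4x gives S·θS = −2x;
-- together (1 − 4x)·θ(S·B) = 0, so S·B = 1.  The closed form of the descent count gives
-- (1 − 4x + 2x²)·B = 1 − 2x + 2x·popGF, and multiplying by S yields the stated equation.

open import Defs

module WordStatistics where
  open import Data.Nat using (ℕ; zero; suc; pred; _+_; _*_; _∸_; _≤_; _<_; _<ᵇ_; z≤n; s≤s)
  open import Data.Nat.Properties
    using (+-identityʳ; +-comm; +-assoc; *-distribʳ-+; *-distribˡ-+; *-identityʳ; *-zeroʳ; 0∸n≡0; n≤1+n; ≤-refl; ≤-reflexive; ≤-trans; ≤-pred)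
  open import Data.Nat.ListAction using (sum)
  open import Data.Nat.ListAction.Properties using (sum-++)
  open import Data.Nat.Tactic.RingSolver using (solve-∀)
  open import Data.Bool using (if_then_else_)
  open import Data.List using (List; []; _∷_; [_]; _++_; map; concatMap; upTo)
  open import Data.List.Properties using (map-++; map-cong; map-∘; upTo-∷ʳ)
  open import Data.List.Relation.Unary.All as All using (All; []; _∷_)
  open import Data.List.Relation.Unary.All.Properties using (map⁺; concat⁺; applyUpTo⁺₁)
  open import Function using (_∘_)
  open import Relation.Binary.PropositionalEquality using (_≡_; refl; sym; trans; cong; cong₂; module ≡-Reasoning)
  open ≡-Reasoning

  sum-map-++ : ∀ {A : Set} (f : A → ℕ) xs ys →
               sum (map f (xs ++ ys)) ≡ sum (map f xs) + sum (map f ys)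
  sum-map-++ f xs ys = trans (cong sum (map-++ f xs ys)) (sum-++ (map f xs) (map f ys))

  sum-map-concatMap : ∀ {A B : Set} (f : B → ℕ) (g : A → List B) xs →
                      sum (map f (concatMap g xs)) ≡ sum (map (λ x → sum (map f (g x))) xs)
  sum-map-concatMap f g []       = refl
  sum-map-concatMap f g (x ∷ xs) =
    trans (sum-map-++ f (g x) (concatMap g xs)) (cong (sum (map f (g x)) +_) (sum-map-concatMap f g xs))

  sum-map-cong : ∀ {A : Set} {f g : A → ℕ} → (∀ x → f x ≡ g x) → ∀ xs → sum (map f xs) ≡ sum (map g xs)
  sum-map-cong f≗g xs = cong sum (map-cong f≗g xs)

  sum-map-+ : ∀ {A : Set} (f g : A → ℕ) xs →
              sum (map (λ x → f x + g x) xs) ≡ sum (map f xs) + sum (map g xs)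
  sum-map-+ f g []       = refl
  sum-map-+ f g (x ∷ xs) rewrite sum-map-+ f g xs = interchange (f x) (g x) _ _
    where
    interchange : ∀ a b c d → a + b + (c + d) ≡ a + c + (b + d)
    interchange = solve-∀

  sum-map-*ʳ : ∀ {A : Set} (f : A → ℕ) c xs → sum (map (λ x → f x * c) xs) ≡ sum (map f xs) * c
  sum-map-*ʳ f c []       = refl
  sum-map-*ʳ f c (x ∷ xs) rewrite sum-map-*ʳ f c xs = sym (*-distribʳ-+ c (f x) (sum (map f xs)))

  sum-map-zero : ∀ {A : Set} {f : A → ℕ} {xs} → All (λ x → f x ≡ 0) xs → sum (map f xs) ≡ 0
  sum-map-zero []         = refl
  sum-map-zero (p ∷ ps) rewrite p = sum-map-zero ps

  sum-map-upTo-suc : ∀ (f : ℕ → ℕ) m → sum (map f (upTo (suc m))) ≡ sum (map f (upTo m)) + f m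
  sum-map-upTo-suc f m = begin
    sum (map f (upTo (suc m)))             ≡⟨ cong (sum ∘ map f) (sym (upTo-∷ʳ m)) ⟩
    sum (map f (upTo m ++ [ m ]))          ≡⟨ sum-map-++ f (upTo m) [ m ] ⟩
    sum (map f (upTo m)) + (f m + 0)       ≡⟨ cong (sum (map f (upTo m)) +_) (+-identityʳ (f m)) ⟩
    sum (map f (upTo m)) + f m             ∎

  ⟦_≤_⟧ : ℕ → ℕ → ℕ
  ⟦ zero  ≤ l     ⟧ = 1
  ⟦ suc k ≤ zero  ⟧ = 0
  ⟦ suc k ≤ suc l ⟧ = ⟦ k ≤ l ⟧

  ⟦≤⟧-suc-right : ∀ k l → ⟦ k ≤ suc l ⟧ ≡ ⟦ pred k ≤ l ⟧
  ⟦≤⟧-suc-right zero    l = refl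
  ⟦≤⟧-suc-right (suc k) l = refl

  ⟦≤⟧-vanishes : ∀ {k l} → l < k → ⟦ k ≤ l ⟧ ≡ 0
  ⟦≤⟧-vanishes {suc k} {zero}  _         = refl
  ⟦≤⟧-vanishes {suc k} {suc l} (s≤s l<k) = ⟦≤⟧-vanishes l<k

  ⟦≤⟧-holds : ∀ {k l} → k ≤ l → ⟦ k ≤ l ⟧ ≡ 1
  ⟦≤⟧-holds {zero}          _         = refl
  ⟦≤⟧-holds {suc k} {suc l} (s≤s k≤l) = ⟦≤⟧-holds k≤l

  <ᵇ-indicator : ∀ k l → (if k <ᵇ l then 1 else 0) ≡ ⟦ suc k ≤ l ⟧
  <ᵇ-indicator k       zero    = refl
  <ᵇ-indicator zero    (suc l) = refl
  <ᵇ-indicator (suc k) (suc l) = <ᵇ-indicator k l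

  ∸-split : ∀ m k → m ∸ k ≡ m ∸ suc k + ⟦ suc k ≤ m ⟧
  ∸-split zero    zero    = refl
  ∸-split zero    (suc k) = refl
  ∸-split (suc m) zero    = sym (+-comm m 1)
  ∸-split (suc m) (suc k) = ∸-split m k

  sum-⟦≤⟧-upTo : ∀ k m → sum (map ⟦ k ≤_⟧ (upTo m)) ≡ m ∸ k
  sum-⟦≤⟧-upTo k zero    = sym (0∸n≡0 k)
  sum-⟦≤⟧-upTo k (suc m) = begin
    sum (map ⟦ k ≤_⟧ (upTo (suc m)))      ≡⟨ sum-map-upTo-suc ⟦ k ≤_⟧ m ⟩
    sum (map ⟦ k ≤_⟧ (upTo m)) + ⟦ k ≤ m ⟧ ≡⟨ cong (_+ ⟦ k ≤ m ⟧) (sum-⟦≤⟧-upTo k m) ⟩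
    m ∸ k + ⟦ k ≤ m ⟧                      ≡⟨ sym (∸-split (suc m) k) ⟩
    suc m ∸ k                              ∎

  sum-⟦≤⟧-below : ∀ k l m → m ≤ l → sum (map (λ i → ⟦ k ≤ i ⟧ * ⟦ suc i ≤ l ⟧) (upTo m)) ≡ m ∸ k
  sum-⟦≤⟧-below k l zero    _   = sym (0∸n≡0 k)
  sum-⟦≤⟧-below k l (suc m) m<l = begin
    sum (map f (upTo (suc m)))              ≡⟨ sum-map-upTo-suc f m ⟩
    sum (map f (upTo m)) + ⟦ k ≤ m ⟧ * ⟦ suc m ≤ l ⟧
      ≡⟨ cong₂ _+_ (sum-⟦≤⟧-below k l m (≤-trans (n≤1+n m) m<l)) (cong (⟦ k ≤ m ⟧ *_) (⟦≤⟧-holds m<l)) ⟩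
    m ∸ k + ⟦ k ≤ m ⟧ * 1                   ≡⟨ cong (m ∸ k +_) (*-identityʳ ⟦ k ≤ m ⟧) ⟩
    m ∸ k + ⟦ k ≤ m ⟧                        ≡⟨ sym (∸-split (suc m) k) ⟩
    suc m ∸ k                                ∎
    where
    f : ℕ → ℕ
    f = λ i → ⟦ k ≤ i ⟧ * ⟦ suc i ≤ l ⟧

  sum-⟦≤⟧-strictlyBelow : ∀ k l → sum (map (λ i → ⟦ k ≤ i ⟧ * ⟦ suc i ≤ l ⟧) (upTo (suc (suc l)))) ≡ l ∸ k
  sum-⟦≤⟧-strictlyBelow k l = begin
    sum (map f (upTo (suc (suc l))))                  ≡⟨ sum-map-upTo-suc f (suc l) ⟩
    sum (map f (upTo (suc l))) + f (suc l)            ≡⟨ cong (_+ f (suc l)) (sum-map-upTo-suc f l) ⟩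
    sum (map f (upTo l)) + f l + f (suc l)
      ≡⟨ cong₂ (λ a b → sum (map f (upTo l)) + a + b) (vanish l ≤-refl) (vanish (suc l) (n≤1+n l)) ⟩
    sum (map f (upTo l)) + 0 + 0                      ≡⟨ cong (_+ 0) (+-identityʳ _) ⟩
    sum (map f (upTo l)) + 0                          ≡⟨ +-identityʳ _ ⟩
    sum (map f (upTo l))                              ≡⟨ sum-⟦≤⟧-below k l l ≤-refl ⟩
    l ∸ k                                             ∎
    where
    f : ℕ → ℕ
    f = λ i → ⟦ k ≤ i ⟧ * ⟦ suc i ≤ l ⟧
    vanish : ∀ i → l ≤ i → f i ≡ 0
    vanish i l≤i = trans (cong (⟦ k ≤ i ⟧ *_) (⟦≤⟧-vanishes (s≤s l≤i))) (*-zeroʳ ⟦ k ≤ i ⟧)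

  lastLetter : List ℕ → ℕ
  lastLetter w = lastOr w 0

  lastLetter-snoc : ∀ w i → lastLetter (w ++ [ i ]) ≡ i
  lastLetter-snoc []          i = refl
  lastLetter-snoc (x ∷ [])    i = refl
  lastLetter-snoc (x ∷ y ∷ w) i = lastLetter-snoc (y ∷ w) i

  descents-snoc : ∀ w i → descents (w ++ [ i ]) ≡ descents w + ⟦ suc i ≤ lastLetter w ⟧
  descents-snoc []          i = refl
  descents-snoc (x ∷ [])    i = trans (+-identityʳ _) (<ᵇ-indicator i x)
  descents-snoc (x ∷ y ∷ w) i rewrite descents-snoc (y ∷ w) i =
    sym (+-assoc (if y <ᵇ x then 1 else 0) (descents (y ∷ w)) _)

  extensions : List ℕ → List (List ℕ)
  extensions w = map (λ i → w ++ [ i ]) (upTo (suc (suc (lastLetter w))))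

  sum-CatalanWords-suc : ∀ (f : List ℕ → ℕ) n →
    sum (map f (CatalanWords (suc (suc n)))) ≡ sum (map (λ w → sum (map f (extensions w))) (CatalanWords (suc n)))
  sum-CatalanWords-suc f n = sum-map-concatMap f extensions (CatalanWords (suc n))

  sum-extensions : ∀ (f : List ℕ → ℕ) w →
    sum (map f (extensions w)) ≡ sum (map (λ i → f (w ++ [ i ])) (upTo (suc (suc (lastLetter w)))))
  sum-extensions f w = cong sum (sym (map-∘ {g = f} {f = λ i → w ++ [ i ]} (upTo (suc (suc (lastLetter w))))))

  lastLetter<length : ∀ n → All (λ w → lastLetter w < suc n) (CatalanWords (suc n))
  lastLetter<length zero    = s≤s z≤n ∷ []
  lastLetter<length (suc n) = concat⁺ (map⁺ (All.map extension-bound (lastLetter<length n)))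
    where
    extension-bound : ∀ {w} → lastLetter w < suc n → All (λ v → lastLetter v < suc (suc n)) (extensions w)
    extension-bound {w} ℓ<n = map⁺ (applyUpTo⁺₁ _ _ λ {i} i<ℓ+2 →
      s≤s (≤-trans (≤-reflexive (lastLetter-snoc w i)) (≤-trans (≤-pred i<ℓ+2) ℓ<n)))

  countLast≥ : ℕ → ℕ → ℕ
  countLast≥ k n = sum (map (λ w → ⟦ k ≤ lastLetter w ⟧) (CatalanWords n))

  descentsLast≥ : ℕ → ℕ → ℕ
  descentsLast≥ k n = sum (map (λ w → ⟦ k ≤ lastLetter w ⟧ * descents w) (CatalanWords n))

  countLast≥-extensions : ∀ k w →
    sum (map (λ v → ⟦ k ≤ lastLetter v ⟧) (extensions w)) ≡ suc (suc (lastLetter w)) ∸ k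
  countLast≥-extensions k w = begin
    sum (map (λ v → ⟦ k ≤ lastLetter v ⟧) (extensions w))
      ≡⟨ sum-extensions (λ v → ⟦ k ≤ lastLetter v ⟧) w ⟩
    sum (map (λ i → ⟦ k ≤ lastLetter (w ++ [ i ]) ⟧) (upTo (suc (suc ℓ))))
      ≡⟨ sum-map-cong (λ i → cong ⟦ k ≤_⟧ (lastLetter-snoc w i)) (upTo (suc (suc ℓ))) ⟩
    sum (map ⟦ k ≤_⟧ (upTo (suc (suc ℓ))))
      ≡⟨ sum-⟦≤⟧-upTo k (suc (suc ℓ)) ⟩
    suc (suc ℓ) ∸ k ∎
    where
    ℓ : ℕ
    ℓ = lastLetter w

  descentsLast≥-extensions : ∀ k w →
    sum (map (λ v → ⟦ k ≤ lastLetter v ⟧ * descents v) (extensions w))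
      ≡ (suc (suc (lastLetter w)) ∸ k) * descents w + (lastLetter w ∸ k)
  descentsLast≥-extensions k w = begin
    sum (map (λ v → ⟦ k ≤ lastLetter v ⟧ * descents v) (extensions w))
      ≡⟨ sum-extensions (λ v → ⟦ k ≤ lastLetter v ⟧ * descents v) w ⟩
    sum (map (λ i → ⟦ k ≤ lastLetter (w ++ [ i ]) ⟧ * descents (w ++ [ i ])) I)
      ≡⟨ sum-map-cong snoc I ⟩
    sum (map (λ i → ⟦ k ≤ i ⟧ * d + ⟦ k ≤ i ⟧ * ⟦ suc i ≤ ℓ ⟧) I)
      ≡⟨ sum-map-+ (λ i → ⟦ k ≤ i ⟧ * d) (λ i → ⟦ k ≤ i ⟧ * ⟦ suc i ≤ ℓ ⟧) I ⟩
    sum (map (λ i → ⟦ k ≤ i ⟧ * d) I) + sum (map (λ i → ⟦ k ≤ i ⟧ * ⟦ suc i ≤ ℓ ⟧) I)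
      ≡⟨ cong₂ _+_ (trans (sum-map-*ʳ ⟦ k ≤_⟧ d I) (cong (_* d) (sum-⟦≤⟧-upTo k (suc (suc ℓ)))))
                   (sum-⟦≤⟧-strictlyBelow k ℓ) ⟩
    (suc (suc ℓ) ∸ k) * d + (ℓ ∸ k) ∎
    where
    ℓ : ℕ
    ℓ = lastLetter w
    d : ℕ
    d = descents w
    I : List ℕ
    I = upTo (suc (suc ℓ))
    snoc : ∀ i → ⟦ k ≤ lastLetter (w ++ [ i ]) ⟧ * descents (w ++ [ i ]) ≡ ⟦ k ≤ i ⟧ * d + ⟦ k ≤ i ⟧ * ⟦ suc i ≤ ℓ ⟧
    snoc i = trans (cong₂ (λ a b → ⟦ k ≤ a ⟧ * b) (lastLetter-snoc w i) (descents-snoc w i))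
                   (*-distribˡ-+ ⟦ k ≤ i ⟧ d ⟦ suc i ≤ ℓ ⟧)

  ∸-split-extension : ∀ ℓ k → suc (suc ℓ) ∸ k ≡ suc (suc ℓ) ∸ suc k + ⟦ pred k ≤ ℓ ⟧
  ∸-split-extension ℓ k = trans (∸-split (suc (suc ℓ)) k) (cong (suc (suc ℓ) ∸ suc k +_) (⟦≤⟧-suc-right k ℓ))

  -- A word ends in exactly k iff it arises by appending k to a word ending in at least k − 1 (any word, if k = 0).
  countLast≥-step : ∀ k n →
    countLast≥ k (suc (suc n)) ≡ countLast≥ (suc k) (suc (suc n)) + countLast≥ (pred k) (suc n)
  countLast≥-step k n = begin
    countLast≥ k (suc (suc n))
      ≡⟨ sum-CatalanWords-suc _ n ⟩
    sum (map (λ w → sum (map (λ v → ⟦ k ≤ lastLetter v ⟧) (extensions w))) W)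
      ≡⟨ sum-map-cong split W ⟩
    sum (map (λ w → sum (map (λ v → ⟦ suc k ≤ lastLetter v ⟧) (extensions w)) + ⟦ pred k ≤ lastLetter w ⟧) W)
      ≡⟨ sum-map-+ _ _ W ⟩
    sum (map (λ w → sum (map (λ v → ⟦ suc k ≤ lastLetter v ⟧) (extensions w))) W) + countLast≥ (pred k) (suc n)
      ≡⟨ cong (_+ countLast≥ (pred k) (suc n)) (sym (sum-CatalanWords-suc _ n)) ⟩
    countLast≥ (suc k) (suc (suc n)) + countLast≥ (pred k) (suc n) ∎
    where
    W : List (List ℕ)
    W = CatalanWords (suc n)
    split : ∀ w → sum (map (λ v → ⟦ k ≤ lastLetter v ⟧) (extensions w))
                ≡ sum (map (λ v → ⟦ suc k ≤ lastLetter v ⟧) (extensions w)) + ⟦ pred k ≤ lastLetter w ⟧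
    split w = begin
      sum (map (λ v → ⟦ k ≤ lastLetter v ⟧) (extensions w))  ≡⟨ countLast≥-extensions k w ⟩
      suc (suc ℓ) ∸ k                                         ≡⟨ ∸-split-extension ℓ k ⟩
      suc (suc ℓ) ∸ suc k + ⟦ pred k ≤ ℓ ⟧
        ≡⟨ cong (_+ ⟦ pred k ≤ ℓ ⟧) (sym (countLast≥-extensions (suc k) w)) ⟩
      sum (map (λ v → ⟦ suc k ≤ lastLetter v ⟧) (extensions w)) + ⟦ pred k ≤ ℓ ⟧ ∎
      where
      ℓ : ℕ
      ℓ = lastLetter w

  descentsLast≥-step : ∀ k n →
    descentsLast≥ k (suc (suc n))
      ≡ descentsLast≥ (suc k) (suc (suc n)) + descentsLast≥ (pred k) (suc n) + countLast≥ (suc k) (suc n)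
  descentsLast≥-step k n = begin
    descentsLast≥ k (suc (suc n))
      ≡⟨ sum-CatalanWords-suc _ n ⟩
    sum (map (λ w → E k w) W)
      ≡⟨ sum-map-cong split W ⟩
    sum (map (λ w → E (suc k) w + ⟦ pred k ≤ lastLetter w ⟧ * descents w + ⟦ suc k ≤ lastLetter w ⟧) W)
      ≡⟨ sum-map-+ _ _ W ⟩
    sum (map (λ w → E (suc k) w + ⟦ pred k ≤ lastLetter w ⟧ * descents w) W) + countLast≥ (suc k) (suc n)
      ≡⟨ cong (_+ countLast≥ (suc k) (suc n)) (sum-map-+ _ _ W) ⟩
    sum (map (E (suc k)) W) + descentsLast≥ (pred k) (suc n) + countLast≥ (suc k) (suc n)
      ≡⟨ cong (λ a → a + descentsLast≥ (pred k) (suc n) + countLast≥ (suc k) (suc n)) (sym (sum-CatalanWords-suc _ n)) ⟩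
    descentsLast≥ (suc k) (suc (suc n)) + descentsLast≥ (pred k) (suc n) + countLast≥ (suc k) (suc n) ∎
    where
    W : List (List ℕ)
    W = CatalanWords (suc n)
    E : ℕ → List ℕ → ℕ
    E j w = sum (map (λ v → ⟦ j ≤ lastLetter v ⟧ * descents v) (extensions w))
    rearrange : ∀ a b c e d → (a + b) * d + (c + e) ≡ a * d + c + b * d + e
    rearrange = solve-∀
    split : ∀ w → E k w ≡ E (suc k) w + ⟦ pred k ≤ lastLetter w ⟧ * descents w + ⟦ suc k ≤ lastLetter w ⟧
    split w = begin
      E k w                                                   ≡⟨ descentsLast≥-extensions k w ⟩
      (suc (suc ℓ) ∸ k) * d + (ℓ ∸ k)                         ≡⟨ cong₂ (λ a b → a * d + b) (∸-split-extension ℓ k) (∸-split ℓ k) ⟩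
      (suc (suc ℓ) ∸ suc k + ⟦ pred k ≤ ℓ ⟧) * d + (ℓ ∸ suc k + ⟦ suc k ≤ ℓ ⟧)
        ≡⟨ rearrange (suc (suc ℓ) ∸ suc k) ⟦ pred k ≤ ℓ ⟧ (ℓ ∸ suc k) ⟦ suc k ≤ ℓ ⟧ d ⟩
      (suc (suc ℓ) ∸ suc k) * d + (ℓ ∸ suc k) + ⟦ pred k ≤ ℓ ⟧ * d + ⟦ suc k ≤ ℓ ⟧
        ≡⟨ cong (λ a → a + ⟦ pred k ≤ ℓ ⟧ * d + ⟦ suc k ≤ ℓ ⟧) (sym (descentsLast≥-extensions (suc k) w)) ⟩
      E (suc k) w + ⟦ pred k ≤ ℓ ⟧ * d + ⟦ suc k ≤ ℓ ⟧ ∎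
      where
      ℓ : ℕ
      ℓ = lastLetter w
      d : ℕ
      d = descents w

  countLast≥-vanishes : ∀ {k n} → suc n ≤ k → countLast≥ k (suc n) ≡ 0
  countLast≥-vanishes {n = n} n<k = sum-map-zero (All.map (λ ℓ<n → ⟦≤⟧-vanishes (≤-trans ℓ<n n<k)) (lastLetter<length n))

  descentsLast≥-vanishes : ∀ {k n} → suc n ≤ k → descentsLast≥ k (suc n) ≡ 0
  descentsLast≥-vanishes {n = n} n<k =
    sum-map-zero (All.map (λ ℓ<n → cong (_* _) (⟦≤⟧-vanishes (≤-trans ℓ<n n<k))) (lastLetter<length n))

module Binomials where
  open import Data.Nat as ℕ using (ℕ; zero; suc; _≤_; _<_; z≤n; s≤s)
  open import Data.Nat.Properties as ℕ using (+-suc; +-identityʳ; m≤m+n; m+n∸m≡n)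
  open import Data.Nat.Combinatorics using (_C_; nCk+nC[k+1]≡[n+1]C[k+1]; nCk≡nC[n∸k]; nCn≡1; nC1≡n)
  open import Data.Nat.Combinatorics.Specification using (k>n⇒nCk≡0)
  open import Data.Integer using (ℤ; +_; _+_; _-_; _*_)
  import Data.Integer.Properties as ℤ
  open import Data.Integer.Tactic.RingSolver using (solve-∀)
  open import Relation.Binary.PropositionalEquality using (_≡_; refl; sym; trans; cong; cong₂; module ≡-Reasoning)

  -- Opaque, so that n C k is never unfolded into its factorial definition by rewrite or the ring solver.
  opaque
    binomial : ℕ → ℕ → ℤ
    binomial n k = + (n C k)

    binomial-unfold : ∀ n k → binomial n k ≡ + (n C k)
    binomial-unfold n k = refl

    binomial-pascal : ∀ n k → binomial (suc n) (suc k) ≡ binomial n k + binomial n (suc k)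
    binomial-pascal n k = cong +_ (sym (nCk+nC[k+1]≡[n+1]C[k+1] n k))

    binomial-vanishes : ∀ {n k} → n < k → binomial n k ≡ + 0
    binomial-vanishes n<k = cong +_ (k>n⇒nCk≡0 n<k)

    binomial-diagonal : ∀ n → binomial n n ≡ + 1
    binomial-diagonal n = cong +_ (nCn≡1 n)

    binomial-zero : ∀ n → binomial n 0 ≡ + 1
    binomial-zero n = refl

    binomial-symmetric : ∀ {n} j k → j ℕ.+ k ≡ n → binomial n j ≡ binomial n k
    binomial-symmetric j k refl = cong +_ (trans (nCk≡nC[n∸k] (m≤m+n j k)) (cong ((j ℕ.+ k) C_) (m+n∸m≡n j k)))

    binomial-one : ∀ n → binomial n 1 ≡ + n
    binomial-one n = cong +_ (nC1≡n n)

  binomial-absorption : ∀ n k → + suc k * binomial (suc n) (suc k) ≡ + suc n * binomial n k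
  binomial-absorption zero zero
    rewrite binomial-diagonal 1 | binomial-diagonal 0 = refl
  binomial-absorption zero (suc k)
    rewrite binomial-vanishes {1} {suc (suc k)} (s≤s (s≤s z≤n)) | binomial-vanishes {0} {suc k} (s≤s z≤n) =
    ℤ.*-zeroʳ (+ suc (suc k))
  binomial-absorption (suc n) zero
    rewrite binomial-one (suc (suc n)) | binomial-zero (suc n) = solve (+ suc (suc n))
    where
    solve : ∀ m → + 1 * m ≡ m * + 1
    solve = solve-∀
  binomial-absorption (suc n) (suc k) = begin
    + suc (suc k) * binomial (suc (suc n)) (suc (suc k))  ≡⟨ cong (+ suc (suc k) *_) (binomial-pascal (suc n) (suc k)) ⟩
    (+ 1 + (+ 1 + + k)) * (u + v)                          ≡⟨ split-factor (+ k) u v ⟩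
    (+ 1 + + k) * u + u + (+ 1 + (+ 1 + + k)) * v          ≡⟨ cong₂ (λ a b → a + u + b) (binomial-absorption n k) (binomial-absorption n (suc k)) ⟩
    (+ 1 + + n) * x + u + (+ 1 + + n) * y                  ≡⟨ collect (+ n) x y u ⟩
    (+ 1 + + n) * (x + y) + u                              ≡⟨ cong (λ z → (+ 1 + + n) * z + u) (sym (binomial-pascal n k)) ⟩
    (+ 1 + + n) * u + u                                    ≡⟨ absorb (+ n) u ⟩
    + suc (suc n) * binomial (suc n) (suc k)               ∎
    where
    open ≡-Reasoning
    u : ℤ
    u = binomial (suc n) (suc k)
    v : ℤ
    v = binomial (suc n) (suc (suc k))
    x : ℤ
    x = binomial n k
    y : ℤ
    y = binomial n (suc k)
    split-factor : ∀ K u v → (+ 1 + (+ 1 + K)) * (u + v) ≡ (+ 1 + K) * u + u + (+ 1 + (+ 1 + K)) * v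
    split-factor = solve-∀
    collect : ∀ N x y u → (+ 1 + N) * x + u + (+ 1 + N) * y ≡ (+ 1 + N) * (x + y) + u
    collect = solve-∀
    absorb : ∀ N u → (+ 1 + N) * u + u ≡ (+ 1 + (+ 1 + N)) * u
    absorb = solve-∀

  binomial-pascal² : ∀ n k → binomial (suc (suc n)) (suc (suc k)) ≡ binomial n k + + 2 * binomial n (suc k) + binomial n (suc (suc k))
  binomial-pascal² n k = begin
    binomial (suc (suc n)) (suc (suc k))
      ≡⟨ binomial-pascal (suc n) (suc k) ⟩
    binomial (suc n) (suc k) + binomial (suc n) (suc (suc k))
      ≡⟨ cong₂ _+_ (binomial-pascal n k) (binomial-pascal n (suc k)) ⟩
    (binomial n k + binomial n (suc k)) + (binomial n (suc k) + binomial n (suc (suc k)))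
      ≡⟨ collect (binomial n k) (binomial n (suc k)) (binomial n (suc (suc k))) ⟩
    binomial n k + + 2 * binomial n (suc k) + binomial n (suc (suc k)) ∎
    where
    open ≡-Reasoning
    collect : ∀ a b c → (a + b) + (b + c) ≡ a + + 2 * b + c
    collect = solve-∀

  ballot : ℕ → ℕ → ℤ
  ballot n g = binomial (suc (n ℕ.+ g)) (suc n) - binomial (suc (n ℕ.+ g)) (suc (suc n))

  ballot-zero : ∀ n → ballot n 0 ≡ + 1
  ballot-zero n rewrite +-identityʳ n | binomial-diagonal (suc n) | binomial-vanishes (ℕ.n<1+n (suc n)) = refl

  ballot-pascal : ∀ m g → ballot (suc m) (suc g) ≡ ballot (suc m) g + ballot m (suc g)
  ballot-pascal m g
    rewrite +-suc m g | binomial-pascal (suc (suc (m ℕ.+ g))) (suc (suc m)) | binomial-pascal (suc (suc (m ℕ.+ g))) (suc m)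
    = telescope (binomial X (suc m)) (binomial X (suc (suc m))) (binomial X (suc (suc (suc m))))
    where
    X : ℕ
    X = suc (suc (m ℕ.+ g))
    telescope : ∀ a b c → (a + b) - (b + c) ≡ (b - c) + (a - b)
    telescope = solve-∀

  binomial-middle : ∀ m → binomial (suc (m ℕ.+ m)) m ≡ binomial (suc (m ℕ.+ m)) (suc m)
  binomial-middle m = binomial-symmetric m (suc m) (+-suc m m)

  ballot-reflect : ∀ m → ballot m (suc m) ≡ ballot m m
  ballot-reflect m
    rewrite +-suc m m | binomial-pascal (suc (m ℕ.+ m)) (suc m) | binomial-pascal (suc (m ℕ.+ m)) m | binomial-middle m
    = cancel (binomial X (suc m)) (binomial X (suc (suc m)))
    where
    X : ℕ
    X = suc (m ℕ.+ m)
    cancel : ∀ a b → (a + a) - (a + b) ≡ a - b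
    cancel = solve-∀

  ballot-diagonal : ∀ m → ballot (suc m) (suc m) ≡ ballot (suc m) m + ballot m m
  ballot-diagonal m = trans (ballot-pascal m m) (cong (λ b → ballot (suc m) m + b) (ballot-reflect m))

  descentTotal : ℕ → ℕ → ℤ
  descentTotal k zero    = + 0
  descentTotal k (suc h) = binomial X (suc (suc (suc (k ℕ.+ h)))) + + suc k * binomial X (suc (suc (k ℕ.+ h)))
    where
    X : ℕ
    X = suc (k ℕ.+ h ℕ.+ h)

  descentTotal-one : ∀ k → descentTotal k 1 ≡ + 0
  descentTotal-one k = begin
    binomial X (suc (suc (suc (k ℕ.+ 0)))) + + suc k * binomial X (suc (suc (k ℕ.+ 0)))
      ≡⟨ cong₂ (λ a b → a + + suc k * b) (binomial-vanishes (s≤s (s≤s (ℕ.m≤n⇒m≤1+n X≤)))) (binomial-vanishes (s≤s (s≤s X≤))) ⟩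
    + 0 + + suc k * + 0 ≡⟨ trans (ℤ.+-identityˡ _) (ℤ.*-zeroʳ (+ suc k)) ⟩
    + 0 ∎
    where
    open ≡-Reasoning
    X : ℕ
    X = suc (k ℕ.+ 0 ℕ.+ 0)
    X≤ : k ℕ.+ 0 ℕ.+ 0 ≤ k ℕ.+ 0
    X≤ = ℕ.≤-reflexive (+-identityʳ (k ℕ.+ 0))

  descentTotal-zero-step : ∀ h →
    descentTotal 0 (suc (suc h)) ≡ descentTotal 1 (suc h) + descentTotal 0 (suc h) + ballot (suc h) h
  descentTotal-zero-step h rewrite +-suc h h =
    identity (binomial (suc Y) (4 ℕ.+ h)) (binomial (suc Y) (3 ℕ.+ h))
             (binomial Y (2 ℕ.+ h)) (binomial Y (3 ℕ.+ h)) (binomial Y (4 ℕ.+ h)) (binomial Z (2 ℕ.+ h)) (binomial Z (3 ℕ.+ h))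
             (binomial-pascal Y (3 ℕ.+ h)) (binomial-pascal Y (2 ℕ.+ h)) (binomial-pascal Z (2 ℕ.+ h))
    where
    Y : ℕ
    Y = suc (suc (h ℕ.+ h))
    Z : ℕ
    Z = suc (h ℕ.+ h)
    identity : ∀ p q y₂ y₃ y₄ z₂ z₃ → p ≡ y₃ + y₄ → q ≡ y₂ + y₃ → y₃ ≡ z₂ + z₃ →
               p + + 1 * q ≡ (y₄ + + 2 * y₃) + (z₃ + + 1 * z₂) + (y₂ - y₃)
    identity _ _ y₂ _ y₄ z₂ z₃ refl refl refl = solve y₂ y₄ z₂ z₃
      where
      solve : ∀ y₂ y₄ z₂ z₃ → (z₂ + z₃ + y₄) + + 1 * (y₂ + (z₂ + z₃))
                            ≡ (y₄ + + 2 * (z₂ + z₃)) + (z₃ + + 1 * z₂) + (y₂ - (z₂ + z₃))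
      solve = solve-∀

  descentTotal-step : ∀ k h →
    descentTotal (suc k) (suc (suc h))
      ≡ descentTotal (suc (suc k)) (suc h) + descentTotal k (suc (suc h)) + ballot (k ℕ.+ suc (suc h)) h
  descentTotal-step k h rewrite +-suc k (suc h) | +-suc k h | +-suc (k ℕ.+ h) h =
    identity (+ k) (binomial (suc Y) (5 ℕ.+ a)) (binomial (suc Y) (4 ℕ.+ a))
             (binomial Y (3 ℕ.+ a)) (binomial Y (4 ℕ.+ a)) (binomial Y (5 ℕ.+ a))
             (binomial-pascal Y (4 ℕ.+ a)) (binomial-pascal Y (3 ℕ.+ a))
    where
    a : ℕ
    a = k ℕ.+ h
    Y : ℕ
    Y = suc (suc (suc (k ℕ.+ h ℕ.+ h)))
    identity : ∀ K p q y₃ y₄ y₅ → p ≡ y₄ + y₅ → q ≡ y₃ + y₄ →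
               p + (+ 2 + K) * q ≡ (y₅ + (+ 3 + K) * y₄) + (y₄ + (+ 1 + K) * y₃) + (y₃ - y₄)
    identity K _ _ y₃ y₄ y₅ refl refl = solve K y₃ y₄ y₅
      where
      solve : ∀ K y₃ y₄ y₅ → (y₄ + y₅) + (+ 2 + K) * (y₃ + y₄)
                           ≡ (y₅ + (+ 3 + K) * y₄) + (y₄ + (+ 1 + K) * y₃) + (y₃ - y₄)
      solve = solve-∀

  descentTotal-zero : ∀ m → descentTotal 0 (suc (suc m)) ≡ binomial (4 ℕ.+ (m ℕ.+ m)) m
  descentTotal-zero m rewrite +-suc m m = begin
    binomial (suc Y) (4 ℕ.+ m) + + 1 * binomial (suc Y) (3 ℕ.+ m)
      ≡⟨ cong (λ b → binomial (suc Y) (4 ℕ.+ m) + b) (ℤ.*-identityˡ _) ⟩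
    binomial (suc Y) (4 ℕ.+ m) + binomial (suc Y) (3 ℕ.+ m)
      ≡⟨ ℤ.+-comm (binomial (suc Y) (4 ℕ.+ m)) (binomial (suc Y) (3 ℕ.+ m)) ⟩
    binomial (suc Y) (3 ℕ.+ m) + binomial (suc Y) (4 ℕ.+ m)
      ≡⟨ sym (binomial-pascal (suc Y) (3 ℕ.+ m)) ⟩
    binomial (suc (suc Y)) (4 ℕ.+ m)
      ≡⟨ binomial-symmetric (4 ℕ.+ m) m refl ⟩
    binomial (4 ℕ.+ (m ℕ.+ m)) m ∎
    where
    open ≡-Reasoning
    Y : ℕ
    Y = suc (suc (m ℕ.+ m))

module ClosedForms where
  open WordStatistics
  open Binomials
  open import Data.Nat as ℕ using (ℕ; zero; suc; pred; _≤_; s≤s)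
  open import Data.Nat.Properties using (+-suc; +-comm; +-identityʳ; ≤-reflexive; m≤n⇒m≤1+n)
  open import Data.Integer as ℤ using (+_)
  open import Data.Nat.Combinatorics using (_C_)
  open import Data.Nat.Tactic.RingSolver using (solve-∀)
  import Data.Integer.Properties as ℤ
  open import Relation.Binary.PropositionalEquality using (_≡_; refl; sym; trans; cong; cong₂; module ≡-Reasoning)
  open ≡-Reasoning

  countLast≥-closed : ∀ g k {n} → k ℕ.+ g ≡ n → + countLast≥ k (suc n) ≡ ballot n g
  countLast≥-closed zero    zero    refl = sym (ballot-zero 0)
  countLast≥-closed zero    (suc k) refl = begin
    + countLast≥ (suc k) (suc (suc (k ℕ.+ 0)))
      ≡⟨ cong +_ (countLast≥-step (suc k) (k ℕ.+ 0)) ⟩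
    + (countLast≥ (suc (suc k)) (suc (suc (k ℕ.+ 0))) ℕ.+ countLast≥ k (suc (k ℕ.+ 0)))
      ≡⟨ cong (λ a → + (a ℕ.+ countLast≥ k (suc (k ℕ.+ 0)))) (countLast≥-vanishes (s≤s (s≤s (≤-reflexive (+-identityʳ k))))) ⟩
    + countLast≥ k (suc (k ℕ.+ 0))   ≡⟨ countLast≥-closed zero k refl ⟩
    ballot (k ℕ.+ 0) 0               ≡⟨ trans (ballot-zero _) (sym (ballot-zero _)) ⟩
    ballot (suc k ℕ.+ 0) 0           ∎
  countLast≥-closed (suc g) zero    refl = begin
    + countLast≥ 0 (suc (suc g))                           ≡⟨ cong +_ (countLast≥-step 0 g) ⟩
    + countLast≥ 1 (suc (suc g)) ℤ.+ + countLast≥ 0 (suc g) ≡⟨ cong₂ ℤ._+_ (countLast≥-closed g 1 refl) (countLast≥-closed g 0 refl) ⟩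
    ballot (suc g) g ℤ.+ ballot g g                         ≡⟨ sym (ballot-diagonal g) ⟩
    ballot (suc g) (suc g)                                  ∎
  countLast≥-closed (suc g) (suc k) refl = begin
    + countLast≥ (suc k) (suc (suc m))
      ≡⟨ cong +_ (countLast≥-step (suc k) m) ⟩
    + countLast≥ (suc (suc k)) (suc (suc m)) ℤ.+ + countLast≥ k (suc m)
      ≡⟨ cong₂ ℤ._+_ (countLast≥-closed g (suc (suc k)) (cong suc (sym (+-suc k g)))) (countLast≥-closed (suc g) k refl) ⟩
    ballot (suc m) g ℤ.+ ballot m (suc g)
      ≡⟨ sym (ballot-pascal m g) ⟩
    ballot (suc m) (suc g) ∎
    where
    m : ℕ
    m = k ℕ.+ suc g

  descentsLast≥-stepℤ : ∀ k m {a b c} →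
    + descentsLast≥ (suc k) (suc (suc m)) ≡ a → + descentsLast≥ (pred k) (suc m) ≡ b → + countLast≥ (suc k) (suc m) ≡ c →
    + descentsLast≥ k (suc (suc m)) ≡ a ℤ.+ b ℤ.+ c
  descentsLast≥-stepℤ k m ≡a ≡b ≡c = trans (cong +_ (descentsLast≥-step k m)) (cong₂ ℤ._+_ (cong₂ ℤ._+_ ≡a ≡b) ≡c)

  descentsLast≥-closed : ∀ g k {n} → k ℕ.+ g ≡ n → + descentsLast≥ k (suc n) ≡ descentTotal k g
  descentsLast≥-closed zero          zero    refl = refl
  descentsLast≥-closed zero          (suc k) refl =
    descentsLast≥-stepℤ (suc k) (k ℕ.+ 0) (cong +_ (descentsLast≥-vanishes (s≤s (s≤s k+0≤k))))
                                          (descentsLast≥-closed zero k refl)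
                                          (cong +_ (countLast≥-vanishes (s≤s (m≤n⇒m≤1+n k+0≤k))))
    where
    k+0≤k : k ℕ.+ 0 ≤ k
    k+0≤k = ≤-reflexive (+-identityʳ k)
  descentsLast≥-closed (suc zero)    zero    refl = sym (descentTotal-one 0)
  descentsLast≥-closed (suc (suc h)) zero    refl = trans
    (descentsLast≥-stepℤ 0 (suc h) (descentsLast≥-closed (suc h) 1 refl) (descentsLast≥-closed (suc h) 0 refl)
                                   (countLast≥-closed h 1 refl))
    (sym (descentTotal-zero-step h))
  descentsLast≥-closed (suc zero)    (suc k) refl = trans
    (descentsLast≥-stepℤ (suc k) (k ℕ.+ 1) (descentsLast≥-closed 0 (suc (suc k)) (cong suc (sym (+-suc k 0))))
                                           (descentsLast≥-closed 1 k refl)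
                                           (cong +_ (countLast≥-vanishes (s≤s (≤-reflexive (+-comm k 1))))))
    (trans (cong (λ a → + 0 ℤ.+ a ℤ.+ + 0) (descentTotal-one k)) (sym (descentTotal-one (suc k))))
  descentsLast≥-closed (suc (suc h)) (suc k) refl = trans
    (descentsLast≥-stepℤ (suc k) (k ℕ.+ suc (suc h))
       (descentsLast≥-closed (suc h) (suc (suc k)) (cong suc (sym (+-suc k (suc h)))))
       (descentsLast≥-closed (suc (suc h)) k refl)
       (countLast≥-closed h (suc (suc k)) (sym (trans (+-suc k (suc h)) (cong suc (+-suc k h))))))
    (sym (descentTotal-step k h))

  popDes≡descentsLast≥0 : ∀ n → popDes n ≡ descentsLast≥ 0 n
  popDes≡descentsLast≥0 n = sum-map-cong (λ w → sym (+-identityʳ (descents w))) (CatalanWords n)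

  popDes-binomial : ∀ m → + popDes (suc (suc (suc m))) ≡ binomial (4 ℕ.+ (m ℕ.+ m)) m
  popDes-binomial m = begin
    + popDes (suc (suc (suc m)))           ≡⟨ cong +_ (popDes≡descentsLast≥0 (suc (suc (suc m)))) ⟩
    + descentsLast≥ 0 (suc (suc (suc m)))  ≡⟨ descentsLast≥-closed (suc (suc m)) 0 refl ⟩
    descentTotal 0 (suc (suc m))           ≡⟨ descentTotal-zero m ⟩
    binomial (4 ℕ.+ (m ℕ.+ m)) m           ∎

  popFormula-binomial : ∀ m → + popFormula (suc (suc (suc m))) ≡ binomial (4 ℕ.+ (m ℕ.+ m)) m
  popFormula-binomial m = trans (cong (λ N → + (N C m)) (cong (ℕ._∸ 2) (double m))) (sym (binomial-unfold _ m))
    where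
    double : ∀ m → 2 ℕ.* (3 ℕ.+ m) ≡ 2 ℕ.+ (4 ℕ.+ (m ℕ.+ m))
    double = solve-∀

  popDes≡popFormula : (n : ℕ) → 1 ≤ n → popDes n ≡ popFormula n
  popDes≡popFormula (suc zero)                _ = refl
  popDes≡popFormula (suc (suc zero))          _ = refl
  popDes≡popFormula (suc (suc (suc m)))       _ = ℤ.+-injective (trans (popDes-binomial m) (sym (popFormula-binomial m)))

module PowerSeries where
  open import Data.Nat as ℕ using (ℕ; zero; suc; _≤_; _∸_; z≤n; s≤s)
  import Data.Nat.Properties as ℕ
  open import Data.Integer using (ℤ; +_; _+_; _*_)
  import Data.Integer.Properties as ℤ
  open import Data.Integer.Tactic.RingSolver using (solve-∀)
  open import Data.List using ([]; _∷_; [_])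
  open import Data.Sum using (inj₁; inj₂)
  open import Relation.Binary.PropositionalEquality using (_≡_; refl; sym; trans; cong; cong₂; module ≡-Reasoning)
  open ≡-Reasoning

  sumTo-cong : ∀ n {f g : ℕ → ℤ} → (∀ i → i ≤ n → f i ≡ g i) → sumTo n f ≡ sumTo n g
  sumTo-cong zero    f≗g = f≗g 0 z≤n
  sumTo-cong (suc n) f≗g = cong₂ _+_ (sumTo-cong n (λ i i≤n → f≗g i (ℕ.m≤n⇒m≤1+n i≤n))) (f≗g (suc n) ℕ.≤-refl)

  sumTo-zero : ∀ n {f : ℕ → ℤ} → (∀ i → i ≤ n → f i ≡ + 0) → sumTo n f ≡ + 0
  sumTo-zero zero    f≗0 = f≗0 0 z≤n
  sumTo-zero (suc n) f≗0 =
    cong₂ _+_ (sumTo-zero n (λ i i≤n → f≗0 i (ℕ.m≤n⇒m≤1+n i≤n))) (f≗0 (suc n) ℕ.≤-refl)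

  sumTo-+ : ∀ n (f g : ℕ → ℤ) → sumTo n (λ i → f i + g i) ≡ sumTo n f + sumTo n g
  sumTo-+ zero    f g = refl
  sumTo-+ (suc n) f g rewrite sumTo-+ n f g = interchange (sumTo n f) (sumTo n g) (f (suc n)) (g (suc n))
    where
    interchange : ∀ a b c d → a + b + (c + d) ≡ a + c + (b + d)
    interchange = solve-∀

  sumTo-*ˡ : ∀ n c (f : ℕ → ℤ) → sumTo n (λ i → c * f i) ≡ c * sumTo n f
  sumTo-*ˡ zero    c f = refl
  sumTo-*ˡ (suc n) c f rewrite sumTo-*ˡ n c f = sym (ℤ.*-distribˡ-+ c (sumTo n f) (f (suc n)))

  sumTo-head : ∀ n (f : ℕ → ℤ) → sumTo (suc n) f ≡ f 0 + sumTo n (λ i → f (suc i))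
  sumTo-head zero    f = refl
  sumTo-head (suc n) f rewrite sumTo-head n f = ℤ.+-assoc (f 0) _ _

  sumTo-reverse : ∀ n (f : ℕ → ℤ) → sumTo n f ≡ sumTo n (λ i → f (n ∸ i))
  sumTo-reverse zero    f = refl
  sumTo-reverse (suc n) f = begin
    sumTo n f + f (suc n)                   ≡⟨ cong (_+ f (suc n)) (sumTo-reverse n f) ⟩
    sumTo n (λ i → f (n ∸ i)) + f (suc n)   ≡⟨ ℤ.+-comm _ (f (suc n)) ⟩
    f (suc n) + sumTo n (λ i → f (n ∸ i))   ≡⟨ sym (sumTo-head n (λ i → f (suc n ∸ i))) ⟩
    sumTo (suc n) (λ i → f (suc n ∸ i))     ∎

  shift : FPS → FPS
  shift f i = f (suc i)

  ⊛-suc : ∀ f g n → (f ⊛ g) (suc n) ≡ f 0 * g (suc n) + (shift f ⊛ g) n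
  ⊛-suc f g n = sumTo-head n (λ i → f i * g (suc n ∸ i))

  ⊛-congˡ : ∀ {f f′} g → f ≈ f′ → f ⊛ g ≈ f′ ⊛ g
  ⊛-congˡ g f≈f′ n = sumTo-cong n (λ i _ → cong (_* g (n ∸ i)) (f≈f′ i))

  ⊛-congʳ : ∀ f {g g′} → g ≈ g′ → f ⊛ g ≈ f ⊛ g′
  ⊛-congʳ f g≈g′ n = sumTo-cong n (λ i _ → cong (f i *_) (g≈g′ (n ∸ i)))

  ⊛-comm : ∀ f g → f ⊛ g ≈ g ⊛ f
  ⊛-comm f g n = trans (sumTo-reverse n (λ i → f i * g (n ∸ i)))
    (sumTo-cong n (λ i i≤n → trans (cong (λ j → f (n ∸ i) * g j) (ℕ.m∸[m∸n]≡n i≤n)) (ℤ.*-comm (f (n ∸ i)) (g i))))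

  ⊛-distribˡ-⊕ : ∀ h f g → h ⊛ (f ⊕ g) ≈ (h ⊛ f) ⊕ (h ⊛ g)
  ⊛-distribˡ-⊕ h f g n = trans (sumTo-cong n (λ i _ → ℤ.*-distribˡ-+ (h i) (f (n ∸ i)) (g (n ∸ i)))) (sumTo-+ n _ _)

  ⊛-distribʳ-⊕ : ∀ h f g → (f ⊕ g) ⊛ h ≈ (f ⊛ h) ⊕ (g ⊛ h)
  ⊛-distribʳ-⊕ h f g n = trans (sumTo-cong n (λ i _ → ℤ.*-distribʳ-+ (h (n ∸ i)) (f i) (g i))) (sumTo-+ n _ _)

  ⊛-scaleˡ : ∀ c f g n → ((λ i → c * f i) ⊛ g) n ≡ c * (f ⊛ g) n
  ⊛-scaleˡ c f g n = trans (sumTo-cong n (λ i _ → ℤ.*-assoc c (f i) (g (n ∸ i)))) (sumTo-*ˡ n c _)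

  ⊛-assoc : ∀ f g h → (f ⊛ g) ⊛ h ≈ f ⊛ (g ⊛ h)
  ⊛-assoc f g h zero    = ℤ.*-assoc (f 0) (g 0) (h 0)
  ⊛-assoc f g h (suc n) = begin
    ((f ⊛ g) ⊛ h) (suc n)
      ≡⟨ ⊛-suc (f ⊛ g) h n ⟩
    f 0 * g 0 * h (suc n) + (shift (f ⊛ g) ⊛ h) n
      ≡⟨ cong (λ a → f 0 * g 0 * h (suc n) + a) (⊛-congˡ h (⊛-suc f g) n) ⟩
    f 0 * g 0 * h (suc n) + (((λ i → f 0 * g (suc i)) ⊕ (shift f ⊛ g)) ⊛ h) n
      ≡⟨ cong (λ a → f 0 * g 0 * h (suc n) + a) (⊛-distribʳ-⊕ h (λ i → f 0 * g (suc i)) (shift f ⊛ g) n) ⟩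
    f 0 * g 0 * h (suc n) + (((λ i → f 0 * g (suc i)) ⊛ h) n + ((shift f ⊛ g) ⊛ h) n)
      ≡⟨ cong₂ (λ a b → f 0 * g 0 * h (suc n) + (a + b)) (⊛-scaleˡ (f 0) (shift g) h n) (⊛-assoc (shift f) g h n) ⟩
    f 0 * g 0 * h (suc n) + (f 0 * (shift g ⊛ h) n + (shift f ⊛ (g ⊛ h)) n)
      ≡⟨ regroup (f 0) (g 0) (h (suc n)) ((shift g ⊛ h) n) ((shift f ⊛ (g ⊛ h)) n) ⟩
    f 0 * (g 0 * h (suc n) + (shift g ⊛ h) n) + (shift f ⊛ (g ⊛ h)) n
      ≡⟨ cong (λ a → f 0 * a + (shift f ⊛ (g ⊛ h)) n) (sym (⊛-suc g h n)) ⟩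
    f 0 * (g ⊛ h) (suc n) + (shift f ⊛ (g ⊛ h)) n
      ≡⟨ sym (⊛-suc f (g ⊛ h) n) ⟩
    (f ⊛ (g ⊛ h)) (suc n) ∎
    where
    regroup : ∀ a b c d e → a * b * c + (a * d + e) ≡ a * (b * c + d) + e
    regroup = solve-∀

  θ : FPS → FPS
  θ f n = + n * f n

  θ-⊛ : ∀ f g → θ (f ⊛ g) ≈ (θ f ⊛ g) ⊕ (f ⊛ θ g)
  θ-⊛ f g n = begin
    + n * sumTo n (λ i → f i * g (n ∸ i))                                  ≡⟨ sym (sumTo-*ˡ n (+ n) _) ⟩
    sumTo n (λ i → + n * (f i * g (n ∸ i)))                                ≡⟨ sumTo-cong n split ⟩
    sumTo n (λ i → θ f i * g (n ∸ i) + f i * θ g (n ∸ i))                  ≡⟨ sumTo-+ n _ _ ⟩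
    ((θ f ⊛ g) ⊕ (f ⊛ θ g)) n                                              ∎
    where
    distribute : ∀ a b x y → (a + b) * (x * y) ≡ (a * x) * y + x * (b * y)
    distribute = solve-∀
    split : ∀ i → i ≤ n → + n * (f i * g (n ∸ i)) ≡ θ f i * g (n ∸ i) + f i * θ g (n ∸ i)
    split i i≤n = trans (cong (λ m → + m * (f i * g (n ∸ i))) (sym (ℕ.m+[n∸m]≡n i≤n)))
                        (distribute (+ i) (+ (n ∸ i)) (f i) (g (n ∸ i)))

  poly-[]-⊛ : ∀ f n → (poly [] ⊛ f) n ≡ + 0
  poly-[]-⊛ f n = sumTo-zero n (λ _ _ → refl)

  poly-[-]-⊛ : ∀ c f n → (poly [ c ] ⊛ f) n ≡ c * f n
  poly-[-]-⊛ c f zero    = refl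
  poly-[-]-⊛ c f (suc n) = trans (⊛-suc (poly [ c ]) f n) (trans (cong (λ x → c * f (suc n) + x) (poly-[]-⊛ f n)) (ℤ.+-identityʳ _))

  poly-linear-⊛ : ∀ a b f n → (poly (a ∷ b ∷ []) ⊛ f) (suc n) ≡ a * f (suc n) + b * f n
  poly-linear-⊛ a b f n = trans (⊛-suc (poly (a ∷ b ∷ [])) f n) (cong (λ x → a * f (suc n) + x) (poly-[-]-⊛ b f n))

  poly-quadratic-⊛ : ∀ a b c f n → (poly (a ∷ b ∷ c ∷ []) ⊛ f) (suc (suc n)) ≡ a * f (suc (suc n)) + (b * f (suc n) + c * f n)
  poly-quadratic-⊛ a b c f n =
    trans (⊛-suc (poly (a ∷ b ∷ c ∷ [])) f (suc n)) (cong (λ x → a * f (suc (suc n)) + x) (poly-linear-⊛ b c f n))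

  ⊛-identityʳ : ∀ f → f ⊛ poly [ + 1 ] ≈ f
  ⊛-identityʳ f n = trans (⊛-comm f (poly [ + 1 ]) n) (trans (poly-[-]-⊛ (+ 1) f n) (ℤ.*-identityˡ (f n)))

  ⊛-cancel-zero : ∀ g f → g 0 ≡ + 1 → (∀ n → (g ⊛ f) n ≡ + 0) → ∀ n → f n ≡ + 0
  ⊛-cancel-zero g f g₀≡1 g⊛f≈0 n = below n n ℕ.≤-refl
    where
    below : ∀ m i → i ≤ m → f i ≡ + 0
    below zero    zero    _   = trans (sym (ℤ.*-identityˡ (f 0))) (trans (cong (_* f 0) (sym g₀≡1)) (g⊛f≈0 0))
    below (suc m) i     i≤m with ℕ.m≤n⇒m<n∨m≡n i≤m
    ... | inj₁ (s≤s i≤m′) = below m i i≤m′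
    ... | inj₂ refl       = begin
      f (suc m)                                ≡⟨ sym (ℤ.*-identityˡ (f (suc m))) ⟩
      + 1 * f (suc m)                          ≡⟨ cong (_* f (suc m)) (sym g₀≡1) ⟩
      g 0 * f (suc m)                          ≡⟨ sym (ℤ.+-identityʳ _) ⟩
      g 0 * f (suc m) + + 0                    ≡⟨ cong (λ x → g 0 * f (suc m) + x) (sym (sumTo-zero m earlier)) ⟩
      g 0 * f (suc m) + (shift g ⊛ f) m        ≡⟨ sym (⊛-suc g f m) ⟩
      (g ⊛ f) (suc m)                          ≡⟨ g⊛f≈0 (suc m) ⟩
      + 0                                      ∎
      where
      earlier : ∀ j → j ≤ m → shift g j * f (m ∸ j) ≡ + 0
      earlier j _ = trans (cong (shift g j *_) (below m (m ∸ j) (ℕ.m∸n≤m m j))) (ℤ.*-zeroʳ (shift g j))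

  ⊛-assoc-comm : ∀ f g h → f ⊛ g ⊛ h ≈ g ⊛ (f ⊛ h)
  ⊛-assoc-comm f g h n = trans (⊛-congˡ h (⊛-comm f g) n) (⊛-assoc g f h n)

module GeneratingFunction where
  open Binomials
  open ClosedForms
  open PowerSeries
  open import Data.Nat as ℕ using (ℕ; zero; suc)
  import Data.Nat.Properties as ℕ
  import Data.Nat.Tactic.RingSolver as ℕ-Solver
  open import Data.Integer using (ℤ; +_; -_; _+_; _-_; _*_)
  import Data.Integer.Properties as ℤ
  open import Data.Integer.Tactic.RingSolver using (solve-∀)
  open import Data.List using ([]; _∷_; [_])
  open import Relation.Binary.PropositionalEquality using (_≡_; refl; sym; trans; cong; cong₂; _→-setoid_; module ≡-Reasoning)
  import Relation.Binary.Reasoning.Setoid as SetoidReasoning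

  module ≈-Reasoning = SetoidReasoning (ℕ →-setoid ℤ)

  1-4x 1-2x 2x -2x 1-4x+2x² : FPS
  1-4x      = poly (+ 1 ∷ - (+ 4) ∷ [])
  1-2x      = poly (+ 1 ∷ - (+ 2) ∷ [])
  2x        = poly (+ 0 ∷ + 2 ∷ [])
  -2x       = poly (+ 0 ∷ - (+ 2) ∷ [])
  1-4x+2x²  = poly (+ 1 ∷ - (+ 4) ∷ + 2 ∷ [])

  central : FPS
  central n = binomial (n ℕ.+ n) n

  central-recurrence : ∀ n → + suc n * central (suc n) ≡ (+ 2 + + 4 * + n) * central n
  central-recurrence n = begin
    + suc n * binomial (suc n ℕ.+ suc n) (suc n)          ≡⟨ cong (λ N → + suc n * binomial (suc N) (suc n)) (ℕ.+-suc n n) ⟩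
    + suc n * binomial (suc (suc (n ℕ.+ n))) (suc n)      ≡⟨ cong (+ suc n *_) (binomial-pascal (suc (n ℕ.+ n)) n) ⟩
    + suc n * (binomial (suc (n ℕ.+ n)) n + c)            ≡⟨ cong (λ b → + suc n * (b + c)) (binomial-middle n) ⟩
    + suc n * (c + c)                                      ≡⟨ ℤ.*-distribˡ-+ (+ suc n) c c ⟩
    + suc n * c + + suc n * c                              ≡⟨ cong₂ _+_ (binomial-absorption (n ℕ.+ n) n) (binomial-absorption (n ℕ.+ n) n) ⟩
    (+ 1 + (+ n + + n)) * central n + (+ 1 + (+ n + + n)) * central n ≡⟨ collect (+ n) (central n) ⟩
    (+ 2 + + 4 * + n) * central n                          ∎
    where
    open ≡-Reasoning
    c : ℤ
    c = binomial (suc (n ℕ.+ n)) (suc n)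
    collect : ∀ N b → (+ 1 + (N + N)) * b + (+ 1 + (N + N)) * b ≡ (+ 2 + + 4 * N) * b
    collect = solve-∀

  θ-central : 1-4x ⊛ θ central ≈ 2x ⊛ central
  θ-central zero    = refl
  θ-central (suc n) = begin
    (1-4x ⊛ θ central) (suc n)                                   ≡⟨ poly-linear-⊛ (+ 1) (- (+ 4)) (θ central) n ⟩
    + 1 * (+ suc n * central (suc n)) + - (+ 4) * (+ n * central n)  ≡⟨ cong (λ a → + 1 * a + - (+ 4) * (+ n * central n)) (central-recurrence n) ⟩
    + 1 * ((+ 2 + + 4 * + n) * central n) + - (+ 4) * (+ n * central n) ≡⟨ cancel (+ n) (central n) (central (suc n)) ⟩
    + 0 * central (suc n) + + 2 * central n                      ≡⟨ sym (poly-linear-⊛ (+ 0) (+ 2) central n) ⟩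
    (2x ⊛ central) (suc n)                                       ∎
    where
    open ≡-Reasoning
    cancel : ∀ N x z → + 1 * ((+ 2 + + 4 * N) * x) + - (+ 4) * (N * x) ≡ + 0 * z + + 2 * x
    cancel = solve-∀

  θ-1-4x : θ 1-4x ≈ -2x ⊕ -2x
  θ-1-4x zero          = refl
  θ-1-4x (suc zero)    = refl
  θ-1-4x (suc (suc n)) = ℤ.*-zeroʳ (+ suc (suc n))

  -2x⊕2x≈0 : -2x ⊕ 2x ≈ poly []
  -2x⊕2x≈0 zero          = refl
  -2x⊕2x≈0 (suc zero)    = refl
  -2x⊕2x≈0 (suc (suc n)) = refl

  +-self-injective : ∀ {x y : ℤ} → x + x ≡ y + y → x ≡ y
  +-self-injective {x} {y} x+x≡y+y = ℤ.*-cancelˡ-≡ (+ 2) x y (trans (double x) (trans x+x≡y+y (sym (double y))))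
    where
    double : ∀ x → + 2 * x ≡ x + x
    double = solve-∀

  central-shift : ∀ j m → central (j ℕ.+ m) ≡ binomial (j ℕ.+ j ℕ.+ (m ℕ.+ m)) (j ℕ.+ m)
  central-shift j m = cong (λ N → binomial N (j ℕ.+ m)) (regroup j m)
    where
    regroup : ∀ j m → j ℕ.+ m ℕ.+ (j ℕ.+ m) ≡ j ℕ.+ j ℕ.+ (m ℕ.+ m)
    regroup = ℕ-Solver.solve-∀

  central-quadratic : ∀ m →
    + 1 * central (4 ℕ.+ m) + (- (+ 4) * central (3 ℕ.+ m) + + 2 * central (2 ℕ.+ m)) ≡ + 2 * binomial (4 ℕ.+ (m ℕ.+ m)) m
  -- Everything is expanded in C(X, m), …, C(X, m + 3) for X = 2m + 4, using C(X, m + 4) = C(X, m).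
  central-quadratic m =
    identity (central-shift 4 m) (central-shift 3 m) (central-shift 2 m)
             (binomial-pascal² (suc (suc X)) (suc (suc m)))
             (binomial-pascal² X m) (binomial-pascal² X (suc m)) (binomial-pascal² X (suc (suc m)))
             (binomial-symmetric (4 ℕ.+ m) m refl)
    where
    X : ℕ
    X = 4 ℕ.+ (m ℕ.+ m)
    identity : ∀ {c₄ c₃ c₂ u p q r a b c d e} → c₄ ≡ u → c₃ ≡ q → c₂ ≡ c →
               u ≡ p + + 2 * q + r → p ≡ a + + 2 * b + c → q ≡ b + + 2 * c + d → r ≡ c + + 2 * d + e → e ≡ a →
               + 1 * c₄ + (- (+ 4) * c₃ + + 2 * c₂) ≡ + 2 * a
    identity {a = a} {b} {c} {d} refl refl refl refl refl refl refl refl = solve a b c d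
      where
      solve : ∀ a b c d → + 1 * ((a + + 2 * b + c) + + 2 * (b + + 2 * c + d) + (c + + 2 * d + a))
                          + (- (+ 4) * (b + + 2 * c + d) + + 2 * c) ≡ + 2 * a
      solve = solve-∀

  1-4x+2x²⊛central : 1-4x+2x² ⊛ central ≈ 1-2x ⊕ (2x ⊛ popGF)
  -- Coefficients 0 to 3: with binomial unfolded, both sides evaluate to the same numbers.
  1-4x+2x²⊛central zero                      = ⊛-congʳ 1-4x+2x² (λ k → binomial-unfold (k ℕ.+ k) k) 0
  1-4x+2x²⊛central (suc zero)                = ⊛-congʳ 1-4x+2x² (λ k → binomial-unfold (k ℕ.+ k) k) 1
  1-4x+2x²⊛central (suc (suc zero))          = ⊛-congʳ 1-4x+2x² (λ k → binomial-unfold (k ℕ.+ k) k) 2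
  1-4x+2x²⊛central (suc (suc (suc zero)))    = ⊛-congʳ 1-4x+2x² (λ k → binomial-unfold (k ℕ.+ k) k) 3
  1-4x+2x²⊛central (suc (suc (suc (suc m)))) = begin
    (1-4x+2x² ⊛ central) (4 ℕ.+ m)
      ≡⟨ poly-quadratic-⊛ (+ 1) (- (+ 4)) (+ 2) central (2 ℕ.+ m) ⟩
    + 1 * central (4 ℕ.+ m) + (- (+ 4) * central (3 ℕ.+ m) + + 2 * central (2 ℕ.+ m))
      ≡⟨ central-quadratic m ⟩
    + 2 * binomial (4 ℕ.+ (m ℕ.+ m)) m
      ≡⟨ cong (+ 2 *_) (popDes-binomial m) ⟨
    + 2 * popGF (3 ℕ.+ m)
      ≡⟨ ℤ.+-identityˡ (+ 2 * popGF (3 ℕ.+ m)) ⟨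
    + 0 + + 2 * popGF (3 ℕ.+ m)
      ≡⟨ cong (_+ + 2 * popGF (3 ℕ.+ m)) (ℤ.*-zeroˡ (popGF (4 ℕ.+ m))) ⟨
    + 0 * popGF (4 ℕ.+ m) + + 2 * popGF (3 ℕ.+ m)
      ≡⟨ poly-linear-⊛ (+ 0) (+ 2) popGF (3 ℕ.+ m) ⟨
    (2x ⊛ popGF) (4 ℕ.+ m)
      ≡⟨ ℤ.+-identityˡ _ ⟨
    (1-2x ⊕ (2x ⊛ popGF)) (4 ℕ.+ m) ∎
    where open ≡-Reasoning

  module _ {S : FPS} (S₀≡1 : S 0 ≡ + 1) (S²≡1-4x : S ⊛ S ≈ 1-4x) where

    S⊛θS≈-2x : S ⊛ θ S ≈ -2x
    S⊛θS≈-2x n = +-self-injective (begin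
      (S ⊛ θ S) n + (S ⊛ θ S) n   ≡⟨ cong (_+ (S ⊛ θ S) n) (⊛-comm S (θ S) n) ⟩
      (θ S ⊛ S) n + (S ⊛ θ S) n   ≡⟨ sym (θ-⊛ S S n) ⟩
      θ (S ⊛ S) n                  ≡⟨ cong (+ n *_) (S²≡1-4x n) ⟩
      θ 1-4x n                     ≡⟨ θ-1-4x n ⟩
      -2x n + -2x n                ∎)
      where open ≡-Reasoning

    1-4x⊛θS≈-2x⊛S : 1-4x ⊛ θ S ≈ -2x ⊛ S
    1-4x⊛θS≈-2x⊛S = begin
      1-4x ⊛ θ S         ≈⟨ ⊛-congˡ (θ S) S²≡1-4x ⟨
      (S ⊛ S) ⊛ θ S      ≈⟨ ⊛-assoc S S (θ S) ⟩
      S ⊛ (S ⊛ θ S)      ≈⟨ ⊛-congʳ S S⊛θS≈-2x ⟩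
      S ⊛ -2x            ≈⟨ ⊛-comm S -2x ⟩
      -2x ⊛ S            ∎
      where open ≈-Reasoning

    S⊛central : FPS
    S⊛central = S ⊛ central

    1-4x⊛θ[S⊛central]≈0 : ∀ n → (1-4x ⊛ θ S⊛central) n ≡ + 0
    1-4x⊛θ[S⊛central]≈0 n = trans (≈-chain n) (sumTo-zero n (λ i _ → cong (_* S⊛central (n ℕ.∸ i)) (-2x⊕2x≈0 i)))
      where
      open ≈-Reasoning
      ≈-chain : 1-4x ⊛ θ S⊛central ≈ (-2x ⊕ 2x) ⊛ S⊛central
      ≈-chain = begin
        1-4x ⊛ θ (S ⊛ central)                               ≈⟨ ⊛-congʳ 1-4x (θ-⊛ S central) ⟩
        1-4x ⊛ ((θ S ⊛ central) ⊕ (S ⊛ θ central))           ≈⟨ ⊛-distribˡ-⊕ 1-4x (θ S ⊛ central) (S ⊛ θ central) ⟩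
        (1-4x ⊛ (θ S ⊛ central)) ⊕ (1-4x ⊛ (S ⊛ θ central))  ≈⟨ (λ n → cong₂ _+_ (θS-part n) (θcentral-part n)) ⟩
        (-2x ⊛ S⊛central) ⊕ (2x ⊛ S⊛central)                 ≈⟨ ⊛-distribʳ-⊕ S⊛central -2x 2x ⟨
        (-2x ⊕ 2x) ⊛ S⊛central                               ∎
        where
        θS-part : 1-4x ⊛ (θ S ⊛ central) ≈ -2x ⊛ S⊛central
        θS-part = begin
          1-4x ⊛ (θ S ⊛ central)   ≈⟨ ⊛-assoc 1-4x (θ S) central ⟨
          (1-4x ⊛ θ S) ⊛ central   ≈⟨ ⊛-congˡ central 1-4x⊛θS≈-2x⊛S ⟩
          (-2x ⊛ S) ⊛ central      ≈⟨ ⊛-assoc -2x S central ⟩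
          -2x ⊛ S⊛central          ∎
        θcentral-part : 1-4x ⊛ (S ⊛ θ central) ≈ 2x ⊛ S⊛central
        θcentral-part = begin
          1-4x ⊛ (S ⊛ θ central)   ≈⟨ ⊛-assoc 1-4x S (θ central) ⟨
          (1-4x ⊛ S) ⊛ θ central   ≈⟨ ⊛-assoc-comm 1-4x S (θ central) ⟩
          S ⊛ (1-4x ⊛ θ central)   ≈⟨ ⊛-congʳ S θ-central ⟩
          S ⊛ (2x ⊛ central)       ≈⟨ ⊛-assoc-comm 2x S central ⟨
          2x ⊛ S ⊛ central         ≈⟨ ⊛-assoc 2x S central ⟩
          2x ⊛ S⊛central           ∎

    S⊛central≈1 : S⊛central ≈ poly [ + 1 ]
    S⊛central≈1 zero    = trans (cong (_* central 0) S₀≡1) (trans (ℤ.*-identityˡ _) (binomial-zero 0))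
    S⊛central≈1 (suc n) = ℤ.*-cancelˡ-≡ (+ suc n) (S⊛central (suc n)) (+ 0)
      (trans (⊛-cancel-zero 1-4x (θ S⊛central) refl 1-4x⊛θ[S⊛central]≈0 (suc n)) (sym (ℤ.*-zeroʳ (+ suc n))))

    1-4x+2x²≈S⊛[1-2x⊕2x⊛popGF] : 1-4x+2x² ≈ (S ⊛ 1-2x) ⊕ (S ⊛ (2x ⊛ popGF))
    1-4x+2x²≈S⊛[1-2x⊕2x⊛popGF] = begin
      1-4x+2x²                          ≈⟨ ⊛-identityʳ 1-4x+2x² ⟨
      1-4x+2x² ⊛ poly [ + 1 ]           ≈⟨ ⊛-congʳ 1-4x+2x² S⊛central≈1 ⟨
      1-4x+2x² ⊛ (S ⊛ central)          ≈⟨ ⊛-assoc 1-4x+2x² S central ⟨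
      (1-4x+2x² ⊛ S) ⊛ central          ≈⟨ ⊛-assoc-comm 1-4x+2x² S central ⟩
      S ⊛ (1-4x+2x² ⊛ central)          ≈⟨ ⊛-congʳ S 1-4x+2x²⊛central ⟩
      S ⊛ (1-2x ⊕ (2x ⊛ popGF))         ≈⟨ ⊛-distribˡ-⊕ S 1-2x (2x ⊛ popGF) ⟩
      (S ⊛ 1-2x) ⊕ (S ⊛ (2x ⊛ popGF))   ∎
      where open ≈-Reasoning

    popGF-equation : 2x ⊛ S ⊛ popGF ≈ 1-4x+2x² ⊖ 1-2x ⊛ S
    popGF-equation n = begin
      ((2x ⊛ S) ⊛ popGF) n                      ≡⟨ ⊛-assoc-comm 2x S popGF n ⟩
      a                                          ≡⟨ add-sub q a ⟩
      (q + a) - q                                ≡⟨ cong₂ _-_ (1-4x+2x²≈S⊛[1-2x⊕2x⊛popGF] n) (⊛-comm 1-2x S n) ⟨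
      1-4x+2x² n - (1-2x ⊛ S) n                  ∎
      where
      open ≡-Reasoning
      a : ℤ
      a = (S ⊛ (2x ⊛ popGF)) n
      q : ℤ
      q = (S ⊛ 1-2x) n
      add-sub : ∀ q a → a ≡ (q + a) - q
      add-sub = solve-∀

open import Data.Nat using (ℕ; _≤_)
open import Data.Integer using (+_; -_)
open import Data.List using (_∷_; [])
open import Data.Product using (_×_; _,_)
open import Relation.Binary.PropositionalEquality using (_≡_)
open ClosedForms using (popDes≡popFormula)
open GeneratingFunction using (popGF-equation)

corollary1 : ((n : ℕ) → 1 ≤ n → popDes n ≡ popFormula n)
             × ((S : FPS) → S 0 ≡ + 1
                → S ⊛ S ≈ poly (+ 1 ∷ - (+ 4) ∷ [])
                → poly (+ 0 ∷ + 2 ∷ []) ⊛ S ⊛ popGF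
                  ≈ poly (+ 1 ∷ - (+ 4) ∷ + 2 ∷ []) ⊖ poly (+ 1 ∷ - (+ 2) ∷ []) ⊛ S)
corollary1 = popDes≡popFormula , λ S S₀≡1 S²≡1-4x → popGF-equation {S} S₀≡1 S²≡1-4x
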